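{- For $N\in\mathbb{N}$, \begin{equation*} \sum_{n=1}^{N}\left[\begin{matrix} N \\ n\end{matrix}\right] \frac{(q)_n(q)_{n-1}(a)_{N-n}a^n}{(a)_n(1-q^n)(a)_{N}}=\sum_{n=1}^{N}\frac{aq^{n-1}}{(1-aq^{n-1})^2}. \end{equation*}
   Context: $|q|<1$; $(a)_n=(a;q)_n=(1-a)(1-aq)\cdots(1-aq^{n-1})$ with $(a)_0=1$. The $q$-binomial coefficient is $\left[\begin{matrix} N \\ n\end{matrix}\right]=\frac{(q)_N}{(q)_n(q)_{N-n}}$ for $0\le n\le N$ and $0$ otherwise. $a$ is complex with all denominators nonzero. -}

module Defs where

open import Level using (Level; _⊔_) renaming (suc to lsuc)
open import Data.Nat using (ℕ; zero; suc; _∸_; _≤?_)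
open import Relation.Nullary using (¬_; yes; no)
open import Algebra.Bundles using (CommutativeRing)

-- A field: a nontrivial commutative ring with a (total) inverse operation
-- that is a genuine multiplicative inverse on every nonzero element
-- (the value of 0⁻¹ is irrelevant).
record Field (c ℓ : Level) : Set (lsuc (c ⊔ ℓ)) where
  field
    commutativeRing : CommutativeRing c ℓ
  open CommutativeRing commutativeRing public
  field
    _⁻¹        : Carrier → Carrier
    ⁻¹-inverse : ∀ x → ¬ (x ≈ 0#) → x * (x ⁻¹) ≈ 1#
    0≉1        : ¬ (0# ≈ 1#)

module FieldOps {c ℓ : Level} (F : Field c ℓ) where
  open Field F

  infixl 7 _÷_
  _÷_ : Carrier → Carrier → Carrier
  x ÷ y = x * (y ⁻¹)

  pow : Carrier → ℕ → Carrier
  pow x zero    = 1#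
  pow x (suc n) = pow x n * x

  qPoch : Carrier → Carrier → ℕ → Carrier
  qPoch a q zero    = 1#
  qPoch a q (suc n) = qPoch a q n * (1# - a * pow q n)

  qBinom : Carrier → ℕ → ℕ → Carrier
  qBinom q N n with n ≤? N
  ... | yes _ = qPoch q q N ÷ (qPoch q q n * qPoch q q (N ∸ n))
  ... | no  _ = 0#

  sum1 : ℕ → (ℕ → Carrier) → Carrier
  sum1 zero    f = 0#
  sum1 (suc N) f = sum1 N f + f (suc N)

{-# OPTIONS --safe #-}
-- Write ratio n = (q)_n / (a)_n, so that ratio (n + 1) = ratio n · shift (q^n) with
-- shift t = (1 - q t) / (1 - a t). The summand is weight N n / (1 - q^n)^2, where
-- weight N n = ratio N · ratio n · a^n / ratio (N - n). With the WZ mate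
-- mate N j = - a q^(N-j) · weight N j / (1 - a q^N)^2 one has, for 1 ≤ n ≤ N,
--   summand (N+1) n = summand N n + mate N n - mate N (n-1),
-- a rational identity in q, a, q^(n-1), q^(N-n) once every term is written as weight N (n-1)
-- times a rational function. Summing over n telescopes, and the boundary terms satisfy
-- mate N N + summand (N+1) (N+1) = 0 and - mate N 0 = a q^N / (1 - a q^N)^2, which is exactly
-- the new term on the right; induction on N finishes.
module Submission where

open import Defs
open import Level using (Level)
open import Algebra.Bundles using (CommutativeRing)
open import Algebra.Solver.Ring.AlmostCommutativeRing using (fromCommutativeRing; _-Raw-AlmostCommutative⟶_)
open import Data.Nat as ℕ using (ℕ; zero; suc; _∸_; _≤_; _<_; _≤′_; _≤?_; s≤s; ≤′-refl; ≤′-step)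
open import Data.Nat.Properties using (+-suc; ≤⇒≤′; +-∸-assoc; m∸n≤m; n∸n≡0; ≤-refl; m≤n⇒m≤1+n)
open import Data.Integer as ℤ using (ℤ; +_; -[1+_]; _⊖_; _◃_; sign; ∣_∣)
import Data.Integer.Properties as ℤ
open import Data.Sign.Base as Sign using (Sign)
open import Data.Fin using (Fin)
open import Data.List using (List; []; _∷_; _++_)
open import Data.List.Relation.Unary.All using (All; []; _∷_)
open import Data.List.Relation.Unary.All.Properties using (++⁻)
open import Data.Maybe using (Maybe; just; nothing)
open import Data.Product using (_,_; proj₁; proj₂)
open import Data.Vec using (Vec; []; _∷_; lookup; tabulate)
open import Data.Vec.N-ary using (N-ary; _$ⁿ_)
open import Relation.Nullary using (¬_; yes; no; contradiction)
open import Relation.Binary.PropositionalEquality as ≡ using (_≡_)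

-- The ring solver with ℤ as coefficient ring: normal forms then have canonical coefficients, so
-- identities in which constants cancel (as in 1 - 1 = 0) are proved by refl.
module IntegerCoefficients {c ℓ : Level} (R : CommutativeRing c ℓ) where
  open CommutativeRing R
  open import Relation.Binary.Reasoning.Setoid setoid
  open import Algebra.Properties.Semiring.Mult.TCOptimised semiring
    using (_×_; 1+×; ×-homo-+; ×1-homo-*)
  open import Algebra.Properties.Ring ring
    using (-‿distribˡ-*; -‿distribʳ-*)
  open import Algebra.Properties.AbelianGroup +-abelianGroup
    using (⁻¹-∙-comm; ⁻¹-involutive; ε⁻¹≈ε)

  signed : Sign → Carrier → Carrier
  signed Sign.+ x = x
  signed Sign.- x = - x

  ⟦_⟧ℤ : ℤ → Carrier
  ⟦ i ⟧ℤ = signed (sign i) (∣ i ∣ × 1#)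

  signed-cong : ∀ s {x y} → x ≈ y → signed s x ≈ signed s y
  signed-cong Sign.+ x≈y = x≈y
  signed-cong Sign.- x≈y = -‿cong x≈y

  signed-* : ∀ s t x y → signed (s Sign.* t) (x * y) ≈ signed s x * signed t y
  signed-* Sign.+ Sign.+ x y = refl
  signed-* Sign.+ Sign.- x y = -‿distribʳ-* x y
  signed-* Sign.- Sign.+ x y = -‿distribˡ-* x y
  signed-* Sign.- Sign.- x y = begin
    x * y           ≈⟨ ⁻¹-involutive _ ⟨
    - - (x * y)     ≈⟨ -‿cong (-‿distribˡ-* x y) ⟩
    - (- x * y)     ≈⟨ -‿distribʳ-* (- x) y ⟩
    - x * - y       ∎

  ◃-homo : ∀ s n → ⟦ s ◃ n ⟧ℤ ≈ signed s (n × 1#)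
  ◃-homo Sign.+ zero    = refl
  ◃-homo Sign.- zero    = sym ε⁻¹≈ε
  ◃-homo Sign.+ (suc n) = refl
  ◃-homo Sign.- (suc n) = refl

  ⊖-homo : ∀ m n → ⟦ m ⊖ n ⟧ℤ ≈ m × 1# - n × 1#
  ⊖-homo zero    zero    = sym (-‿inverseʳ 0#)
  ⊖-homo (suc m) zero    = sym (trans (+-congˡ ε⁻¹≈ε) (+-identityʳ _))
  ⊖-homo zero    (suc n) = sym (+-identityˡ _)
  ⊖-homo (suc m) (suc n) = begin
    ⟦ suc m ⊖ suc n ⟧ℤ                      ≡⟨ ≡.cong ⟦_⟧ℤ (ℤ.[1+m]⊖[1+n]≡m⊖n m n) ⟩
    ⟦ m ⊖ n ⟧ℤ                              ≈⟨ ⊖-homo m n ⟩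
    m × 1# - n × 1#                          ≈⟨ cancel-1# (m × 1#) (n × 1#) ⟩
    (1# + m × 1#) - (1# + n × 1#)            ≈⟨ +-cong (1+× m 1#) (-‿cong (1+× n 1#)) ⟨
    suc m × 1# - suc n × 1#                  ∎
    where
    cancel-1# : ∀ x y → x - y ≈ (1# + x) - (1# + y)
    cancel-1# x y = begin
      x - y                     ≈⟨ +-identityˡ _ ⟨
      0# + (x - y)              ≈⟨ +-congʳ (-‿inverseʳ 1#) ⟨
      (1# - 1#) + (x - y)       ≈⟨ +-assoc 1# (- 1#) (x - y) ⟩
      1# + (- 1# + (x - y))     ≈⟨ +-congˡ (+-assoc (- 1#) x (- y)) ⟨
      1# + ((- 1# + x) - y)     ≈⟨ +-congˡ (+-congʳ (+-comm (- 1#) x)) ⟩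
      1# + ((x - 1#) - y)       ≈⟨ +-congˡ (+-assoc x (- 1#) (- y)) ⟩
      1# + (x + (- 1# - y))     ≈⟨ +-assoc 1# x (- 1# - y) ⟨
      (1# + x) + (- 1# - y)     ≈⟨ +-congˡ (⁻¹-∙-comm 1# y) ⟩
      (1# + x) - (1# + y)       ∎

  +-homo : ∀ i j → ⟦ i ℤ.+ j ⟧ℤ ≈ ⟦ i ⟧ℤ + ⟦ j ⟧ℤ
  +-homo -[1+ m ] -[1+ n ] = begin
    - (suc (suc (m ℕ.+ n)) × 1#)            ≡⟨ ≡.cong (λ k → - (suc k × 1#)) (≡.sym (+-suc m n)) ⟩
    - ((suc m ℕ.+ suc n) × 1#)              ≈⟨ -‿cong (×-homo-+ 1# (suc m) (suc n)) ⟩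
    - (suc m × 1# + suc n × 1#)             ≈⟨ ⁻¹-∙-comm _ _ ⟨
    - (suc m × 1#) + - (suc n × 1#)         ∎
  +-homo -[1+ m ] (+ n)    = trans (⊖-homo n (suc m)) (+-comm _ _)
  +-homo (+ m)    -[1+ n ] = ⊖-homo m (suc n)
  +-homo (+ m)    (+ n)    = ×-homo-+ 1# m n

  *-homo : ∀ i j → ⟦ i ℤ.* j ⟧ℤ ≈ ⟦ i ⟧ℤ * ⟦ j ⟧ℤ
  *-homo i j = begin
    ⟦ (s Sign.* t) ◃ (∣ i ∣ ℕ.* ∣ j ∣) ⟧ℤ                     ≈⟨ ◃-homo (s Sign.* t) (∣ i ∣ ℕ.* ∣ j ∣) ⟩
    signed (s Sign.* t) ((∣ i ∣ ℕ.* ∣ j ∣) × 1#)              ≈⟨ signed-cong (s Sign.* t) (×1-homo-* ∣ i ∣ ∣ j ∣) ⟩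
    signed (s Sign.* t) ((∣ i ∣ × 1#) * (∣ j ∣ × 1#))         ≈⟨ signed-* s t _ _ ⟩
    ⟦ i ⟧ℤ * ⟦ j ⟧ℤ                                             ∎
    where s = sign i; t = sign j

  -‿homo : ∀ i → ⟦ ℤ.- i ⟧ℤ ≈ - ⟦ i ⟧ℤ
  -‿homo -[1+ n ]  = sym (⁻¹-involutive _)
  -‿homo (+ zero)  = sym ε⁻¹≈ε
  -‿homo (+ suc n) = refl

  ℤ⟶R : ℤ.+-*-rawRing -Raw-AlmostCommutative⟶ fromCommutativeRing R
  ℤ⟶R = record
    { ⟦_⟧ = ⟦_⟧ℤ ; +-homo = +-homo ; *-homo = *-homo ; -‿homo = -‿homo
    ; 0-homo = refl ; 1-homo = refl }

  ℤ-equality : ∀ i j → Maybe (⟦ i ⟧ℤ ≈ ⟦ j ⟧ℤ)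
  ℤ-equality i j with i ℤ.≟ j
  ... | yes ≡.refl = just refl
  ... | no _       = nothing

  open import Algebra.Solver.Ring ℤ.+-*-rawRing (fromCommutativeRing R) ℤ⟶R ℤ-equality public

module FieldProperties {c ℓ : Level} (F : Field c ℓ) where
  open Field F
  open FieldOps F
  open import Relation.Binary.Reasoning.Setoid setoid

  1≉0 : 1# ≉ 0#
  1≉0 1≈0 = 0≉1 (sym 1≈0)

  *-cancelʳ : ∀ {x y z} → z ≉ 0# → x * z ≈ y * z → x ≈ y
  *-cancelʳ {x} {y} {z} z≉0 xz≈yz = begin
    x                 ≈⟨ *-identityʳ x ⟨
    x * 1#            ≈⟨ *-congˡ (⁻¹-inverse z z≉0) ⟨
    x * (z * z ⁻¹)    ≈⟨ *-assoc x z (z ⁻¹) ⟨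
    x * z * z ⁻¹      ≈⟨ *-congʳ xz≈yz ⟩
    y * z * z ⁻¹      ≈⟨ *-assoc y z (z ⁻¹) ⟩
    y * (z * z ⁻¹)    ≈⟨ *-congˡ (⁻¹-inverse z z≉0) ⟩
    y * 1#            ≈⟨ *-identityʳ y ⟩
    y                 ∎

  *-≉0 : ∀ {x y} → x ≉ 0# → y ≉ 0# → x * y ≉ 0#
  *-≉0 {x} {y} x≉0 y≉0 xy≈0 = x≉0 (*-cancelʳ y≉0 (trans xy≈0 (sym (zeroˡ y))))

  ≉0-resp-≈ : ∀ {x y} → x ≈ y → x ≉ 0# → y ≉ 0#
  ≉0-resp-≈ x≈y x≉0 y≈0 = x≉0 (trans x≈y y≈0)

  x*y≉0⇒x≉0 : ∀ {x y} → x * y ≉ 0# → x ≉ 0#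
  x*y≉0⇒x≉0 {x} {y} xy≉0 x≈0 = xy≉0 (trans (*-congʳ x≈0) (zeroˡ y))

  x*y≉0⇒y≉0 : ∀ {x y} → x * y ≉ 0# → y ≉ 0#
  x*y≉0⇒y≉0 {x} {y} xy≉0 y≈0 = xy≉0 (trans (*-congˡ y≈0) (zeroʳ x))

  ⁻¹-≉0 : ∀ {x} → x ≉ 0# → x ⁻¹ ≉ 0#
  ⁻¹-≉0 {x} x≉0 x⁻¹≈0 = 0≉1 (trans (sym (zeroʳ x)) (trans (*-congˡ (sym x⁻¹≈0)) (⁻¹-inverse x x≉0)))

  ÷-≉0 : ∀ {x y} → x ≉ 0# → y ≉ 0# → x ÷ y ≉ 0#
  ÷-≉0 x≉0 y≉0 = *-≉0 x≉0 (⁻¹-≉0 y≉0)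

  ⁻¹-cong : ∀ {x y} → x ≉ 0# → x ≈ y → x ⁻¹ ≈ y ⁻¹
  ⁻¹-cong {x} {y} x≉0 x≈y = begin
    x ⁻¹                  ≈⟨ *-identityʳ (x ⁻¹) ⟨
    x ⁻¹ * 1#             ≈⟨ *-congˡ (⁻¹-inverse y y≉0) ⟨
    x ⁻¹ * (y * y ⁻¹)     ≈⟨ *-assoc (x ⁻¹) y (y ⁻¹) ⟨
    x ⁻¹ * y * y ⁻¹       ≈⟨ *-congʳ (trans (*-congˡ (sym x≈y)) (trans (*-comm (x ⁻¹) x) (⁻¹-inverse x x≉0))) ⟩
    1# * y ⁻¹             ≈⟨ *-identityˡ (y ⁻¹) ⟩
    y ⁻¹                  ∎
    where y≉0 = ≉0-resp-≈ x≈y x≉0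

module FieldSimplification {c ℓ : Level} (F : Field c ℓ) where
  open import Data.Product using (_×_)
  open Field F
  open FieldOps F
  open import Relation.Binary.Reasoning.Setoid setoid
  module P = IntegerCoefficients commutativeRing
  open P using (Polynomial; ⟦_⟧ℤ; ⟦_⟧↓; prove; solve; _:=_)
  open FieldProperties F using (1≉0; *-cancelʳ; *-≉0; ≉0-resp-≈)

  -- Clearing denominators: an equation between expressions follows from the cross-multiplied
  -- identity of their numerator and denominator polynomials, decided by the ring solver, once
  -- every divisor is nonzero. The nonzero proofs are listed in the order of `divisors`, where
  -- the divisor of e :/ e′ comes before the divisors inside e and then those inside e′.
  infixl 6 _:+_ _:-_
  infixl 7 _:*_ _:/_
  infix  8 :-_
  infix  4 _⊜_

  data Expr (n : ℕ) : Set where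
    var  : Fin n → Expr n
    con  : ℤ → Expr n
    _:+_ _:-_ _:*_ _:/_ : Expr n → Expr n → Expr n
    :-_  : Expr n → Expr n

  _⊜_ : ∀ {n} → Expr n → Expr n → Expr n × Expr n
  _⊜_ = _,_

  ⟦_⟧ : ∀ {n} → Expr n → Vec Carrier n → Carrier
  ⟦ var i   ⟧ ρ = lookup ρ i
  ⟦ con k   ⟧ ρ = ⟦ k ⟧ℤ
  ⟦ e :+ e′ ⟧ ρ = ⟦ e ⟧ ρ + ⟦ e′ ⟧ ρ
  ⟦ e :- e′ ⟧ ρ = ⟦ e ⟧ ρ - ⟦ e′ ⟧ ρ
  ⟦ e :* e′ ⟧ ρ = ⟦ e ⟧ ρ * ⟦ e′ ⟧ ρ
  ⟦ e :/ e′ ⟧ ρ = ⟦ e ⟧ ρ ÷ ⟦ e′ ⟧ ρ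
  ⟦ :- e    ⟧ ρ = - ⟦ e ⟧ ρ

  numerator denominator : ∀ {n} → Expr n → Polynomial n
  numerator (var i)   = P.var i
  numerator (con k)   = P.con k
  numerator (e :+ e′) = numerator e P.:* denominator e′ P.:+ numerator e′ P.:* denominator e
  numerator (e :- e′) = numerator e P.:* denominator e′ P.:- numerator e′ P.:* denominator e
  numerator (e :* e′) = numerator e P.:* numerator e′
  numerator (e :/ e′) = numerator e P.:* denominator e′
  numerator (:- e)    = P.:- numerator e
  denominator (var i)   = P.con (+ 1)
  denominator (con k)   = P.con (+ 1)
  denominator (e :+ e′) = denominator e P.:* denominator e′
  denominator (e :- e′) = denominator e P.:* denominator e′
  denominator (e :* e′) = denominator e P.:* denominator e′
  denominator (e :/ e′) = denominator e P.:* numerator e′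
  denominator (:- e)    = denominator e

  divisors : ∀ {n} → Expr n → Vec Carrier n → List Carrier
  divisors (var i)   ρ = []
  divisors (con k)   ρ = []
  divisors (e :+ e′) ρ = divisors e ρ ++ divisors e′ ρ
  divisors (e :- e′) ρ = divisors e ρ ++ divisors e′ ρ
  divisors (e :* e′) ρ = divisors e ρ ++ divisors e′ ρ
  divisors (e :/ e′) ρ = ⟦ e′ ⟧ ρ ∷ divisors e ρ ++ divisors e′ ρ
  divisors (:- e)    ρ = divisors e ρ

  record IsFraction (x n d : Carrier) : Set ℓ where
    field
      denominator≉0 : d ≉ 0#
      cleared       : x * d ≈ n
  open IsFraction

  sum-fraction : ∀ {x n d x′ n′ d′} → IsFraction x n d → IsFraction x′ n′ d′ →
                 IsFraction (x + x′) (n * d′ + n′ * d) (d * d′)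
  sum-fraction {x} {n} {d} {x′} {n′} {d′} f f′ = record
    { denominator≉0 = *-≉0 (denominator≉0 f) (denominator≉0 f′)
    ; cleared = begin
        (x + x′) * (d * d′)        ≈⟨ solve 4 (λ x x′ d d′ → (x P.:+ x′) P.:* (d P.:* d′) := x P.:* d P.:* d′ P.:+ x′ P.:* d′ P.:* d) refl x x′ d d′ ⟩
        x * d * d′ + x′ * d′ * d   ≈⟨ +-cong (*-congʳ (cleared f)) (*-congʳ (cleared f′)) ⟩
        n * d′ + n′ * d            ∎ }

  difference-fraction : ∀ {x n d x′ n′ d′} → IsFraction x n d → IsFraction x′ n′ d′ →
                        IsFraction (x - x′) (n * d′ - n′ * d) (d * d′)
  difference-fraction {x} {n} {d} {x′} {n′} {d′} f f′ = record
    { denominator≉0 = *-≉0 (denominator≉0 f) (denominator≉0 f′)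
    ; cleared = begin
        (x - x′) * (d * d′)        ≈⟨ solve 4 (λ x x′ d d′ → (x P.:- x′) P.:* (d P.:* d′) := x P.:* d P.:* d′ P.:- x′ P.:* d′ P.:* d) refl x x′ d d′ ⟩
        x * d * d′ - x′ * d′ * d   ≈⟨ +-cong (*-congʳ (cleared f)) (-‿cong (*-congʳ (cleared f′))) ⟩
        n * d′ - n′ * d            ∎ }

  negation-fraction : ∀ {x n d} → IsFraction x n d → IsFraction (- x) (- n) d
  negation-fraction {x} {n} {d} f = record
    { denominator≉0 = denominator≉0 f
    ; cleared = trans (solve 2 (λ x d → (P.:- x) P.:* d := P.:- (x P.:* d)) refl x d) (-‿cong (cleared f)) }

  product-fraction : ∀ {x n d x′ n′ d′} → IsFraction x n d → IsFraction x′ n′ d′ →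
                     IsFraction (x * x′) (n * n′) (d * d′)
  product-fraction {x} {n} {d} {x′} {n′} {d′} f f′ = record
    { denominator≉0 = *-≉0 (denominator≉0 f) (denominator≉0 f′)
    ; cleared = begin
        x * x′ * (d * d′)      ≈⟨ solve 4 (λ x x′ d d′ → x P.:* x′ P.:* (d P.:* d′) := x P.:* d P.:* (x′ P.:* d′)) refl x x′ d d′ ⟩
        x * d * (x′ * d′)      ≈⟨ *-cong (cleared f) (cleared f′) ⟩
        n * n′                 ∎ }

  quotient-fraction : ∀ {x n d x′ n′ d′} → x′ ≉ 0# → IsFraction x n d → IsFraction x′ n′ d′ →
                      IsFraction (x ÷ x′) (n * d′) (d * n′)
  quotient-fraction {x} {n} {d} {x′} {n′} {d′} x′≉0 f f′ = record
    { denominator≉0 = *-≉0 (denominator≉0 f) (≉0-resp-≈ (cleared f′) (*-≉0 x′≉0 (denominator≉0 f′)))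
    ; cleared = begin
        x ÷ x′ * (d * n′)               ≈⟨ *-congˡ (*-congˡ (cleared f′)) ⟨
        x ÷ x′ * (d * (x′ * d′))        ≈⟨ solve 5 (λ x y d z d′ → x P.:* y P.:* (d P.:* (z P.:* d′)) := x P.:* d P.:* d′ P.:* (z P.:* y)) refl x (x′ ⁻¹) d x′ d′ ⟩
        x * d * d′ * (x′ * x′ ⁻¹)       ≈⟨ *-cong (*-congʳ (cleared f)) (⁻¹-inverse x′ x′≉0) ⟩
        n * d′ * 1#                     ≈⟨ *-identityʳ _ ⟩
        n * d′                          ∎ }

  fraction : ∀ {n} (e : Expr n) ρ → All (_≉ 0#) (divisors e ρ) →
             IsFraction (⟦ e ⟧ ρ) (P.⟦ numerator e ⟧ ρ) (P.⟦ denominator e ⟧ ρ)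
  fraction (var i)   ρ _  = record { denominator≉0 = 1≉0 ; cleared = *-identityʳ _ }
  fraction (con k)   ρ _  = record { denominator≉0 = 1≉0 ; cleared = *-identityʳ _ }
  fraction (e :+ e′) ρ nz = let nz₁ , nz₂ = ++⁻ (divisors e ρ) nz in
    sum-fraction (fraction e ρ nz₁) (fraction e′ ρ nz₂)
  fraction (e :- e′) ρ nz = let nz₁ , nz₂ = ++⁻ (divisors e ρ) nz in
    difference-fraction (fraction e ρ nz₁) (fraction e′ ρ nz₂)
  fraction (e :* e′) ρ nz = let nz₁ , nz₂ = ++⁻ (divisors e ρ) nz in
    product-fraction (fraction e ρ nz₁) (fraction e′ ρ nz₂)
  fraction (e :/ e′) ρ (e′≉0 ∷ nz) = let nz₁ , nz₂ = ++⁻ (divisors e ρ) nz in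
    quotient-fraction e′≉0 (fraction e ρ nz₁) (fraction e′ ρ nz₂)
  fraction (:- e)    ρ nz = negation-fraction (fraction e ρ nz)

  close : ∀ {n} → N-ary n (Expr n) (Expr n × Expr n) → Expr n × Expr n
  close f = f $ⁿ tabulate var

  field-≈ : ∀ {n} (ρ : Vec Carrier n) (f : N-ary n (Expr n) (Expr n × Expr n)) →
    let e = proj₁ (close f) ; e′ = proj₂ (close f) in
    All (_≉ 0#) (divisors e ρ ++ divisors e′ ρ) →
    ⟦ numerator e P.:* denominator e′ ⟧↓ ρ ≈ ⟦ numerator e′ P.:* denominator e ⟧↓ ρ →
    ⟦ e ⟧ ρ ≈ ⟦ e′ ⟧ ρ
  field-≈ ρ f nz normal-forms-agree =
    let e = proj₁ (close f) ; e′ = proj₂ (close f)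
        nz₁ , nz₂ = ++⁻ (divisors e ρ) nz
        fr = fraction e ρ nz₁ ; fr′ = fraction e′ ρ nz₂
        d = P.⟦ denominator e ⟧ ρ ; d′ = P.⟦ denominator e′ ⟧ ρ
    in *-cancelʳ (*-≉0 (denominator≉0 fr) (denominator≉0 fr′)) (begin
      ⟦ e ⟧ ρ * (d * d′)                ≈⟨ *-assoc _ d d′ ⟨
      ⟦ e ⟧ ρ * d * d′                  ≈⟨ *-congʳ (cleared fr) ⟩
      P.⟦ numerator e ⟧ ρ * d′          ≈⟨ prove ρ (numerator e P.:* denominator e′) (numerator e′ P.:* denominator e) normal-forms-agree ⟩
      P.⟦ numerator e′ ⟧ ρ * d          ≈⟨ *-congʳ (cleared fr′) ⟨
      ⟦ e′ ⟧ ρ * d′ * d                 ≈⟨ solve 3 (λ x d d′ → x P.:* d′ P.:* d := x P.:* (d P.:* d′)) refl (⟦ e′ ⟧ ρ) d d′ ⟩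
      ⟦ e′ ⟧ ρ * (d * d′)               ∎)

module Sum1Properties {c ℓ : Level} (F : Field c ℓ) where
  open Field F
  open FieldOps F
  open import Relation.Binary.Reasoning.Setoid setoid
  open import Algebra.Properties.CommutativeSemigroup +-commutativeSemigroup using (interchange)
  open IntegerCoefficients commutativeRing using (solve; _:=_; _:+_; _:-_)

  sum1-cong : ∀ N {f g : ℕ → Carrier} → (∀ {m} → m < N → f (suc m) ≈ g (suc m)) → sum1 N f ≈ sum1 N g
  sum1-cong zero    f≈g = refl
  sum1-cong (suc N) f≈g = +-cong (sum1-cong N (λ m<N → f≈g (m≤n⇒m≤1+n m<N))) (f≈g ≤-refl)

  sum1-+ : ∀ N (f g : ℕ → Carrier) → sum1 N (λ n → f n + g n) ≈ sum1 N f + sum1 N g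
  sum1-+ zero    f g = sym (+-identityʳ 0#)
  sum1-+ (suc N) f g = trans (+-congʳ (sum1-+ N f g)) (interchange _ _ _ _)

  sum1-telescope : ∀ N (h : ℕ → Carrier) → sum1 N (λ n → h n - h (n ∸ 1)) ≈ h N - h 0
  sum1-telescope zero    h = sym (-‿inverseʳ (h 0))
  sum1-telescope (suc N) h = begin
    sum1 N (λ n → h n - h (n ∸ 1)) + (h (suc N) - h N)   ≈⟨ +-congʳ (sum1-telescope N h) ⟩
    h N - h 0 + (h (suc N) - h N)                         ≈⟨ solve 3 (λ x y z → x :- y :+ (z :- x) := z :- y) refl (h N) (h 0) (h (suc N)) ⟩
    h (suc N) - h 0                                       ∎

module QIdentity {c ℓ : Level} (F : Field c ℓ) (q a : Field.Carrier F) where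
  open Field F
  open FieldOps F
  open FieldProperties F
  open FieldSimplification F
  open import Relation.Binary.Reasoning.Setoid setoid

  qPoch≉0-≤ : ∀ c {j M} → j ≤ M → qPoch c q M ≉ 0# → qPoch c q j ≉ 0#
  qPoch≉0-≤ c j≤M = go (≤⇒≤′ j≤M)
    where
    go : ∀ {j M} → j ≤′ M → qPoch c q M ≉ 0# → qPoch c q j ≉ 0#
    go ≤′-refl        h = h
    go (≤′-step j≤′M) h = go j≤′M (x*y≉0⇒x≉0 h)

  qPoch-factor≉0 : ∀ c {j M} → j < M → qPoch c q M ≉ 0# → 1# - c * pow q j ≉ 0#
  qPoch-factor≉0 c j<M h = x*y≉0⇒y≉0 (qPoch≉0-≤ c j<M h)

  1-q^[1+j]≉0 : ∀ {j M} → j < M → qPoch q q M ≉ 0# → 1# - pow q (suc j) ≉ 0#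
  1-q^[1+j]≉0 {j} j<M h = ≉0-resp-≈ (+-congˡ (-‿cong (*-comm q (pow q j)))) (qPoch-factor≉0 q j<M h)

  ∸-suc-< : ∀ {m n} → m < n → n ∸ m ≡ suc (n ∸ suc m)
  ∸-suc-< (s≤s m≤n) = +-∸-assoc 1 m≤n

  pow-∸ : ∀ x {m n} → m ≤ n → pow x n ≈ pow x m * pow x (n ∸ m)
  pow-∸ x {zero}  {n}     _         = sym (*-identityˡ (pow x n))
  pow-∸ x {suc m} {suc n} (s≤s m≤n) = begin
    pow x n * x                      ≈⟨ *-congʳ (pow-∸ x m≤n) ⟩
    pow x m * pow x (n ∸ m) * x      ≈⟨ *-assoc _ _ _ ⟩
    pow x m * (pow x (n ∸ m) * x)    ≈⟨ *-congˡ (*-comm _ x) ⟩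
    pow x m * (x * pow x (n ∸ m))    ≈⟨ *-assoc _ _ _ ⟨
    pow x m * x * pow x (n ∸ m)      ∎

  qBinom-≤ : ∀ {N n} → n ≤ N → qBinom q N n ≡ qPoch q q N ÷ (qPoch q q n * qPoch q q (N ∸ n))
  qBinom-≤ {N} {n} n≤N with n ≤? N
  ... | yes _   = ≡.refl
  ... | no  n≰N = contradiction n≤N n≰N

  summand-numerator summand-denominator : ℕ → ℕ → Carrier
  summand-numerator N n = qPoch q q n * qPoch q q (n ∸ 1) * qPoch a q (N ∸ n) * pow a n
  summand-denominator N n = qPoch a q n * (1# - pow q n) * qPoch a q N

  summand : ℕ → ℕ → Carrier
  summand N n = qBinom q N n * summand-numerator N n ÷ summand-denominator N n

  ratio : ℕ → Carrier
  ratio n = qPoch q q n ÷ qPoch a q n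

  weight : ℕ → ℕ → Carrier
  weight N j = ratio N * ratio j * pow a j ÷ ratio (N ∸ j)

  summand≈weight : ∀ {N m} → suc m ≤ N → qPoch q q N ≉ 0# → qPoch a q N ≉ 0# →
                   summand N (suc m) ≈ weight N (suc m) ÷ pow (1# - pow q (suc m)) 2
  summand≈weight {N} {m} m<N qN≉0 aN≉0 = begin
    summand N (suc m)
      ≡⟨ ≡.cong (λ b → b * summand-numerator N (suc m) ÷ summand-denominator N (suc m)) (qBinom-≤ m<N) ⟩
    qPoch q q N ÷ (qPoch q q (suc m) * qPoch q q k) * summand-numerator N (suc m) ÷ summand-denominator N (suc m)
      ≈⟨ field-≈ (qPoch q q N ∷ qPoch a q N ∷ qPoch q q m ∷ qPoch a q m ∷ qPoch q q k ∷ qPoch a q k ∷ pow a m ∷ a ∷ q ∷ pow q m ∷ [])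
           (λ QN AN Qm Am Qk Ak am a q x →
              let one = con (+ 1) ; Qn = Qm :* (one :- q :* x) ; An = Am :* (one :- a :* x) in
              QN :/ (Qn :* Qk) :* (Qn :* Qm :* Ak :* (am :* a)) :/ (An :* (one :- x :* q) :* AN)
              ⊜ (QN :/ AN) :* (Qn :/ An) :* (am :* a) :/ (Qk :/ Ak) :/ (one :* (one :- x :* q) :* (one :- x :* q)))
           (summand-denominator≉0 ∷ *-≉0 qn≉0 qk≉0 ∷ square≉0 ∷ ÷-≉0 qk≉0 ak≉0 ∷ aN≉0 ∷ an≉0 ∷ ak≉0 ∷ [])
           refl ⟩
    weight N (suc m) ÷ pow (1# - pow q (suc m)) 2 ∎
    where
    k = N ∸ suc m
    k≤N = m∸n≤m N (suc m)
    qn≉0 = qPoch≉0-≤ q m<N qN≉0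
    an≉0 = qPoch≉0-≤ a m<N aN≉0
    qk≉0 = qPoch≉0-≤ q k≤N qN≉0
    ak≉0 = qPoch≉0-≤ a k≤N aN≉0
    1-q^n≉0 = 1-q^[1+j]≉0 m<N qN≉0
    summand-denominator≉0 = *-≉0 (*-≉0 an≉0 1-q^n≉0) aN≉0
    square≉0 = *-≉0 (*-≉0 1≉0 1-q^n≉0) 1-q^n≉0

  shift : Carrier → Carrier
  shift t = (1# - q * t) ÷ (1# - a * t)

  shift-cong : ∀ {t u} → 1# - a * t ≉ 0# → t ≈ u → shift t ≈ shift u
  shift-cong 1-at≉0 t≈u = *-cong (+-congˡ (-‿cong (*-congˡ t≈u))) (⁻¹-cong 1-at≉0 (+-congˡ (-‿cong (*-congˡ t≈u))))

  weight-sucˡ : ∀ {N j} → j ≤ N → qPoch q q (suc N) ≉ 0# → qPoch a q (suc N) ≉ 0# →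
                weight (suc N) j ≈ weight N j * shift (pow q N) ÷ shift (pow q (N ∸ j))
  weight-sucˡ {N} {j} j≤N qN≉0 aN≉0 = begin
    weight (suc N) j
      ≡⟨ ≡.cong (λ i → ratio (suc N) * ratio j * pow a j ÷ ratio i) (+-∸-assoc 1 j≤N) ⟩
    ratio (suc N) * ratio j * pow a j ÷ ratio (suc k)
      ≈⟨ field-≈ (qPoch q q N ∷ qPoch a q N ∷ pow q N ∷ ratio j ∷ pow a j ∷ qPoch q q k ∷ qPoch a q k ∷ pow q k ∷ q ∷ a ∷ [])
           (λ QN AN z Rj aj Qk Ak y q a →
              let one = con (+ 1) ; s = λ t → (one :- q :* t) :/ (one :- a :* t) in
              (QN :* (one :- q :* z)) :/ (AN :* (one :- a :* z)) :* Rj :* aj :/ ((Qk :* (one :- q :* y)) :/ (Ak :* (one :- a :* y)))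
              ⊜ (QN :/ AN) :* Rj :* aj :/ (Qk :/ Ak) :* s z :/ s y)
           (ratio[1+k]≉0 ∷ aN≉0 ∷ ak′≉0 ∷ ÷-≉0 1-qy≉0 1-ay≉0 ∷ ÷-≉0 qk≉0 ak≉0 ∷ x*y≉0⇒x≉0 aN≉0 ∷ ak≉0 ∷ x*y≉0⇒y≉0 aN≉0 ∷ 1-ay≉0 ∷ [])
           refl ⟩
    weight N j * shift (pow q N) ÷ shift (pow q k) ∎
    where
    k = N ∸ j
    1+k≤1+N = s≤s (m∸n≤m N j)
    qk′≉0 = qPoch≉0-≤ q 1+k≤1+N qN≉0
    ak′≉0 = qPoch≉0-≤ a 1+k≤1+N aN≉0
    qk≉0 = x*y≉0⇒x≉0 qk′≉0
    ak≉0 = x*y≉0⇒x≉0 ak′≉0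
    1-qy≉0 = x*y≉0⇒y≉0 qk′≉0
    1-ay≉0 = x*y≉0⇒y≉0 ak′≉0
    ratio[1+k]≉0 = ÷-≉0 qk′≉0 ak′≉0

  weight-sucʳ : ∀ {N m} → m < N → qPoch q q N ≉ 0# → qPoch a q N ≉ 0# →
                weight N (suc m) ≈ weight N m * (a * shift (pow q m) * shift (pow q (N ∸ suc m)))
  weight-sucʳ {N} {m} m<N qN≉0 aN≉0 = begin
    weight N (suc m)
      ≈⟨ field-≈ (ratio N ∷ qPoch q q m ∷ qPoch a q m ∷ pow a m ∷ qPoch q q k ∷ qPoch a q k ∷ pow q m ∷ pow q k ∷ q ∷ a ∷ [])
           (λ RN Qm Am am Qk Ak x y q a →
              let one = con (+ 1) ; s = λ t → (one :- q :* t) :/ (one :- a :* t) in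
              RN :* ((Qm :* (one :- q :* x)) :/ (Am :* (one :- a :* x))) :* (am :* a) :/ (Qk :/ Ak)
              ⊜ RN :* (Qm :/ Am) :* am :/ ((Qk :* (one :- q :* y)) :/ (Ak :* (one :- a :* y))) :* (a :* s x :* s y))
           (÷-≉0 qk≉0 ak≉0 ∷ an≉0 ∷ ak≉0 ∷ ratio[1+k]≉0 ∷ x*y≉0⇒x≉0 an≉0 ∷ ak′≉0 ∷ x*y≉0⇒y≉0 an≉0 ∷ x*y≉0⇒y≉0 ak′≉0 ∷ [])
           refl ⟩
    ratio N * ratio m * pow a m ÷ ratio (suc k) * (a * shift (pow q m) * shift (pow q k))
      ≡⟨ ≡.cong (λ i → ratio N * ratio m * pow a m ÷ ratio i * (a * shift (pow q m) * shift (pow q k))) (∸-suc-< m<N) ⟨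
    weight N m * (a * shift (pow q m) * shift (pow q k)) ∎
    where
    k = N ∸ suc m
    1+k≤N : suc k ≤ N
    1+k≤N = ≡.subst (_≤ N) (∸-suc-< m<N) (m∸n≤m N m)
    an≉0 = qPoch≉0-≤ a m<N aN≉0
    qk′≉0 = qPoch≉0-≤ q 1+k≤N qN≉0
    ak′≉0 = qPoch≉0-≤ a 1+k≤N aN≉0
    qk≉0 = x*y≉0⇒x≉0 qk′≉0
    ak≉0 = x*y≉0⇒x≉0 ak′≉0
    ratio[1+k]≉0 = ÷-≉0 qk′≉0 ak′≉0

  -- The terms of wz-step in x = q^m, y = q^(N-m-1), w = weight N m; thus x * q * y = q^N.
  wz-identity : ∀ x y w → let z = x * q * y ; W = w * (a * shift x * shift y) in
    1# - a * x ≉ 0# → 1# - a * y ≉ 0# → 1# - q * y ≉ 0# → 1# - a * z ≉ 0# → 1# - x * q ≉ 0# →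
    W * shift z ÷ shift y ÷ pow (1# - x * q) 2
      ≈ W ÷ pow (1# - x * q) 2 + (- (a * y) * W ÷ pow (1# - a * z) 2 - - (a * (y * q)) * w ÷ pow (1# - a * z) 2)
  wz-identity x y w 1-ax≉0 1-ay≉0 1-qy≉0 1-az≉0 1-xq≉0 =
    field-≈ (q ∷ x ∷ y ∷ a ∷ w ∷ [])
      (λ q x y a w →
         let one = con (+ 1) ; s = λ t → (one :- q :* t) :/ (one :- a :* t)
             sq = λ t → one :* t :* t ; z = x :* q :* y ; W = w :* (a :* s x :* s y) in
         W :* s z :/ s y :/ sq (one :- x :* q)
         ⊜ W :/ sq (one :- x :* q) :+ (:- (a :* y) :* W :/ sq (one :- a :* z) :- :- (a :* (y :* q)) :* w :/ sq (one :- a :* z)))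
      (S≉0 ∷ ÷-≉0 1-qy≉0 1-ay≉0 ∷ 1-ax≉0 ∷ 1-ay≉0 ∷ 1-az≉0 ∷ 1-ay≉0 ∷ S≉0 ∷ 1-ax≉0 ∷ 1-ay≉0 ∷ D≉0 ∷ 1-ax≉0 ∷ 1-ay≉0 ∷ D≉0 ∷ [])
      refl
    where
    S≉0 = *-≉0 (*-≉0 1≉0 1-xq≉0) 1-xq≉0
    D≉0 = *-≉0 (*-≉0 1≉0 1-az≉0) 1-az≉0

  mate : ℕ → ℕ → Carrier
  mate N j = - (a * pow q (N ∸ j)) * weight N j ÷ pow (1# - a * pow q N) 2

  wz-step : ∀ {N m} → m < N → qPoch q q (suc N) ≉ 0# → qPoch a q (suc N) ≉ 0# →
            summand (suc N) (suc m) ≈ summand N (suc m) + (mate N (suc m) - mate N m)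
  wz-step {N} {m} m<N qN≉0 aN≉0 = begin
    summand (suc N) (suc m)                              ≈⟨ summand≈weight (m≤n⇒m≤1+n m<N) qN≉0 aN≉0 ⟩
    weight (suc N) (suc m) ÷ S                           ≈⟨ *-congʳ (weight-sucˡ m<N qN≉0 aN≉0) ⟩
    weight N (suc m) * shift z ÷ shift y ÷ S             ≈⟨ *-congʳ (*-congʳ (*-cong weight≈W (shift-cong 1-az≉0 z≈xqy))) ⟩
    W * shift (x * q * y) ÷ shift y ÷ S                  ≈⟨ wz-identity x y w 1-ax≉0 1-ay≉0 1-qy≉0 1-axqy≉0 1-xq≉0 ⟩
    W ÷ S + (- (a * y) * W ÷ D′ - - (a * (y * q)) * w ÷ D′)
      ≈⟨ +-cong summand≈ (+-cong mate[1+m]≈ (-‿cong mate[m]≈)) ⟨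
    summand N (suc m) + (mate N (suc m) - mate N m)      ∎
    where
    k = N ∸ suc m
    x = pow q m
    y = pow q k
    z = pow q N
    w = weight N m
    W = w * (a * shift x * shift y)
    S = pow (1# - pow q (suc m)) 2
    D′ = pow (1# - a * (x * q * y)) 2
    k<1+N : k < suc N
    k<1+N = s≤s (m∸n≤m N (suc m))
    1-ax≉0 : 1# - a * x ≉ 0#
    1-ax≉0 = qPoch-factor≉0 a (m≤n⇒m≤1+n m<N) aN≉0
    1-ay≉0 : 1# - a * y ≉ 0#
    1-ay≉0 = qPoch-factor≉0 a k<1+N aN≉0
    1-qy≉0 : 1# - q * y ≉ 0#
    1-qy≉0 = qPoch-factor≉0 q k<1+N qN≉0
    1-az≉0 : 1# - a * z ≉ 0#
    1-az≉0 = qPoch-factor≉0 a {N} ≤-refl aN≉0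
    1-xq≉0 : 1# - x * q ≉ 0#
    1-xq≉0 = 1-q^[1+j]≉0 (m≤n⇒m≤1+n m<N) qN≉0
    z≈xqy : z ≈ x * q * y
    z≈xqy = pow-∸ q m<N
    1-az≈1-axqy : 1# - a * z ≈ 1# - a * (x * q * y)
    1-az≈1-axqy = +-congˡ (-‿cong (*-congˡ z≈xqy))
    1-axqy≉0 = ≉0-resp-≈ 1-az≈1-axqy 1-az≉0
    D⁻¹≈D′⁻¹ : pow (1# - a * z) 2 ⁻¹ ≈ D′ ⁻¹
    D⁻¹≈D′⁻¹ = ⁻¹-cong (*-≉0 (*-≉0 1≉0 1-az≉0) 1-az≉0) (*-cong (*-congˡ 1-az≈1-axqy) 1-az≈1-axqy)
    weight≈W : weight N (suc m) ≈ W
    weight≈W = weight-sucʳ m<N (x*y≉0⇒x≉0 qN≉0) (x*y≉0⇒x≉0 aN≉0)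
    summand≈ : summand N (suc m) ≈ W ÷ S
    summand≈ = trans (summand≈weight m<N (x*y≉0⇒x≉0 qN≉0) (x*y≉0⇒x≉0 aN≉0)) (*-congʳ weight≈W)
    mate[1+m]≈ : mate N (suc m) ≈ - (a * y) * W ÷ D′
    mate[1+m]≈ = *-cong (*-congˡ weight≈W) D⁻¹≈D′⁻¹
    mate[m]≈ : mate N m ≈ - (a * (y * q)) * w ÷ D′
    mate[m]≈ = *-cong (*-congʳ (-‿cong (*-congˡ (reflexive (≡.cong (pow q) (∸-suc-< m<N)))))) D⁻¹≈D′⁻¹

  mate-top : ∀ N → qPoch q q (suc N) ≉ 0# → qPoch a q (suc N) ≉ 0# → mate N N + summand (suc N) (suc N) ≈ 0#
  mate-top N qN≉0 aN≉0 = begin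
    mate N N + summand (suc N) (suc N)
      ≈⟨ +-cong (*-congʳ (*-congʳ (-‿cong (*-congˡ y≈1))))
                (trans (summand≈weight {suc N} ≤-refl qN≉0 aN≉0)
                       (*-congʳ (trans (weight-sucʳ {suc N} ≤-refl qN≉0 aN≉0) (*-congʳ (weight-sucˡ {N} ≤-refl qN≉0 aN≉0))))) ⟩
    - (a * 1#) * w ÷ pow (1# - a * z) 2 + w * shift z ÷ shift y * (a * shift z * shift y) ÷ pow (1# - z * q) 2
      ≈⟨ field-≈ (q ∷ a ∷ z ∷ w ∷ y ∷ [])
           (λ q a z w y →
              let one = con (+ 1) ; s = λ t → (one :- q :* t) :/ (one :- a :* t) ; sq = λ t → one :* t :* t in
              :- (a :* one) :* w :/ sq (one :- a :* z) :+ w :* s z :/ s y :* (a :* s z :* s y) :/ sq (one :- z :* q)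
              ⊜ con (+ 0))
           (D≉0 ∷ S≉0 ∷ ÷-≉0 1-qy≉0 1-ay≉0 ∷ 1-az≉0 ∷ 1-ay≉0 ∷ 1-az≉0 ∷ 1-ay≉0 ∷ [])
           refl ⟩
    0# ∎
    where
    w = weight N N
    y = pow q (N ∸ N)
    z = pow q N
    y≈1 : y ≈ 1#
    y≈1 = reflexive (≡.cong (pow q) (n∸n≡0 N))
    N-N<1+N : N ∸ N < suc N
    N-N<1+N = s≤s (m∸n≤m N N)
    1-ay≉0 : 1# - a * y ≉ 0#
    1-ay≉0 = qPoch-factor≉0 a N-N<1+N aN≉0
    1-qy≉0 : 1# - q * y ≉ 0#
    1-qy≉0 = qPoch-factor≉0 q N-N<1+N qN≉0
    1-az≉0 : 1# - a * z ≉ 0#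
    1-az≉0 = qPoch-factor≉0 a {N} ≤-refl aN≉0
    D≉0 = *-≉0 (*-≉0 1≉0 1-az≉0) 1-az≉0
    1-zq≉0 = 1-q^[1+j]≉0 {N} ≤-refl qN≉0
    S≉0 = *-≉0 (*-≉0 1≉0 1-zq≉0) 1-zq≉0

  mate-bottom : ∀ N → qPoch q q N ≉ 0# → qPoch a q (suc N) ≉ 0# →
                - mate N 0 ≈ a * pow q N ÷ pow (1# - a * pow q N) 2
  mate-bottom N qN≉0 aN+1≉0 =
    field-≈ (qPoch q q N ∷ qPoch a q N ∷ a ∷ pow q N ∷ [])
      (λ QN AN a z →
         let one = con (+ 1) ; D = one :* (one :- a :* z) :* (one :- a :* z) ; RN = QN :/ AN in
         :- (:- (a :* z) :* (RN :* (one :/ one) :* one :/ RN) :/ D) ⊜ a :* z :/ D)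
      (D≉0 ∷ ÷-≉0 qN≉0 aN≉0 ∷ aN≉0 ∷ 1≉0 ∷ aN≉0 ∷ D≉0 ∷ [])
      refl
    where
    aN≉0 = x*y≉0⇒x≉0 aN+1≉0
    1-az≉0 = x*y≉0⇒y≉0 aN+1≉0
    D≉0 = *-≉0 (*-≉0 1≉0 1-az≉0) 1-az≉0

  open Sum1Properties F

  rhs-summand : ℕ → Carrier
  rhs-summand n = a * pow q (n ∸ 1) ÷ pow (1# - a * pow q (n ∸ 1)) 2

  summation-identity : ∀ N → qPoch q q N ≉ 0# → qPoch a q N ≉ 0# → sum1 N (summand N) ≈ sum1 N rhs-summand
  summation-identity zero    _    _    = refl
  summation-identity (suc N) qN≉0 aN≉0 = begin
    sum1 N (summand (suc N)) + summand (suc N) (suc N)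
      ≈⟨ +-congʳ (sum1-cong N (λ m<N → wz-step m<N qN≉0 aN≉0)) ⟩
    sum1 N (λ n → summand N n + (mate N n - mate N (n ∸ 1))) + summand (suc N) (suc N)
      ≈⟨ +-congʳ (trans (sum1-+ N _ _) (+-congˡ (sum1-telescope N (mate N)))) ⟩
    sum1 N (summand N) + (mate N N - mate N 0) + summand (suc N) (suc N)
      ≈⟨ field-≈ (sum1 N (summand N) ∷ mate N N ∷ mate N 0 ∷ summand (suc N) (suc N) ∷ []) (λ s t b u → s :+ (t :- b) :+ u ⊜ s :+ ((t :+ u) :- b)) [] refl ⟩
    sum1 N (summand N) + ((mate N N + summand (suc N) (suc N)) - mate N 0)
      ≈⟨ +-cong (summation-identity N (x*y≉0⇒x≉0 qN≉0) (x*y≉0⇒x≉0 aN≉0))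
                (trans (+-congʳ (mate-top N qN≉0 aN≉0)) (trans (+-identityˡ _) (mate-bottom N (x*y≉0⇒x≉0 qN≉0) aN≉0))) ⟩
    sum1 N rhs-summand + rhs-summand (suc N) ∎

theorem3p5 : ∀ {c ℓ : Level} (F : Field c ℓ) → let open Field F in let open FieldOps F in
    ∀ (q a : Carrier) (N : ℕ) →
    ¬ (qPoch q q N ≈ 0#) → ¬ (qPoch a q N ≈ 0#) →
    sum1 N (λ n → qBinom q N n * (qPoch q q n * qPoch q q (n ∸ 1) * qPoch a q (N ∸ n) * pow a n)
                    ÷ (qPoch a q n * (1# - pow q n) * qPoch a q N))
      ≈ sum1 N (λ n → a * pow q (n ∸ 1) ÷ pow (1# - a * pow q (n ∸ 1)) 2)
theorem3p5 F q a = QIdentity.summation-identity F q a
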